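{- Let $k\ge 2$ and $r\ge 0$ be integers and let $G$ be a finite $k$-degenerate graph with $\Delta(G)\le r$. Then for every positive integer $t$, $\tau_t(G)\le kt + kt^2 r^{1-1/t}$.
   Context: A graph is $k$-degenerate if each of its subgraphs contains a vertex of degree at most $k$. For a positive integer $t$, a $t$-tone $k'$-coloring of a graph $G$ is a function $f:V(G)\to\binom{[k']}{t}$ (assigning to each vertex a $t$-element subset of $\{1,\dots,k'\}$) such that $|f(u)\cap f(v)|<d(u,v)$ for all distinct vertices $u,v$, where $d(u,v)$ is the graph distance. $\tau_t(G)$ is the minimum $k'$ such that $G$ has a $t$-tone $k'$-coloring (when the bound is not an integer, the inequality is between real numbers). -}

module Defs where

open import Data.Nat using (ℕ; zero; suc; _+_; _≤_)
open import Data.Bool using (Bool; true; false; if_then_else_)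
open import Data.Fin using (Fin)
open import Data.Fin.Subset using (Subset; _∩_; ∣_∣)
open import Data.List using (map; allFin)
open import Data.Nat.ListAction using (sum)
open import Data.Product using (Σ; _×_; ∃)
open import Relation.Binary.PropositionalEquality using (_≡_; _≢_)
open import Relation.Nullary using (¬_)

record Graph (n : ℕ) : Set where
  field
    adj    : Fin n → Fin n → Bool
    sym    : ∀ u v → adj u v ≡ adj v u
    irrefl : ∀ v → adj v v ≡ false

open Graph public

degIn : {n : ℕ} → (Fin n → Fin n → Bool) → Fin n → ℕ
degIn {n} E v = sum (map (λ u → if E v u then 1 else 0) (allFin n))

degree : {n : ℕ} → Graph n → Fin n → ℕ
degree G v = degIn (adj G) v

MaxDegreeAtMost : {n : ℕ} → Graph n → ℕ → Set
MaxDegreeAtMost G r = ∀ v → degree G v ≤ r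

Degenerate : {n : ℕ} → ℕ → Graph n → Set
Degenerate {n} k G =
  (S : Fin n → Bool) (E : Fin n → Fin n → Bool) →
  (∀ u v → E u v ≡ E v u) →
  (∀ u v → E u v ≡ true → (adj G u v ≡ true) × (S u ≡ true) × (S v ≡ true)) →
  ∃ (λ v → S v ≡ true) →
  ∃ (λ v → (S v ≡ true) × (degIn E v ≤ k))

-- WalkWithin G u v ℓ : there is a walk from u to v of length at most ℓ,
-- i.e. d(u,v) ≤ ℓ.
data WalkWithin {n : ℕ} (G : Graph n) : Fin n → Fin n → ℕ → Set where
  here : ∀ {u ℓ} → WalkWithin G u u ℓ
  step : ∀ {u w v ℓ} → adj G u w ≡ true → WalkWithin G w v ℓ → WalkWithin G u v (suc ℓ)

-- m < d(u,v)   (d(u,v) = ∞ if u,v in different components)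
DistGreater : {n : ℕ} → Graph n → Fin n → Fin n → ℕ → Set
DistGreater G u v m = ¬ WalkWithin G u v m

IsToneColoring : {n : ℕ} → Graph n → (t N : ℕ) → (Fin n → Subset N) → Set
IsToneColoring G t N f =
  (∀ v → ∣ f v ∣ ≡ t) ×
  (∀ u v → u ≢ v → DistGreater G u v ∣ f u ∩ f v ∣)

HasToneColoring : {n : ℕ} → Graph n → (t N : ℕ) → Set
HasToneColoring {n} G t N = Σ (Fin n → Subset N) (IsToneColoring G t N)

module Submission where

-- Let A = kt², and let M be the integer t-th root of A^t·r^(t-1), so that
-- M^t ≤ A^t·r^(t-1) < (M+1)^t; we colour with N = kt + M colours.  Rank the
-- vertices so that each has at most k earlier neighbours (k-degeneracy), and
-- give the vertices t-sets in rank order.  The new vertex v must avoid the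
-- ≤ kt colours of its earlier neighbours, leaving a palette of a ≥ M
-- colours, and for 2 ≤ j ≤ t it must meet the set of every earlier vertex at
-- the end of a length-j walk from v in fewer than j colours.  At most
-- j·k·r^(j-1) such walks exist, and each forbids at most C(t,j)·C(a-j,t-j)
-- of the C(a,t) t-subsets of the palette; the choice of M makes these
-- weights sum to less than C(a,t), so a union bound leaves a valid t-set.

open import Defs
open import Data.Nat using (ℕ; _≤_; _*_; _^_; _∸_)
open import Data.Fin using (Fin)
open import Data.Product using (Σ; _×_)

open import Data.Nat
open import Data.Nat.Properties
open import Data.Nat.Tactic.RingSolver using (solve-∀)
open import Data.Nat.ListAction using (sum)
open import Data.Nat.ListAction.Properties using (sum-++)
open import Data.Unit using (tt)
open import Data.Empty using (⊥-elim)
open import Data.Bool using (Bool; true; false; if_then_else_; _∧_; not)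
import Data.Bool as Bool
open import Data.Bool.Properties using (∧-identityʳ; ∧-zeroʳ)
open import Data.Vec using ([]; _∷_)
open import Data.List using (List; []; _∷_; _++_; map; length; allFin; concatMap)
open import Data.List.Properties using (map-++; map-cong; map-∘; length-tabulate)
open import Data.List.Membership.Propositional using (_∈_; lose; find)
open import Data.List.Membership.Propositional.Properties using (∈-map⁻; ∈-++⁻; ∈-allFin; ∈-concatMap⁺; ∈-concatMap⁻)
open import Data.List.Relation.Unary.Any using (here; there)
open import Data.Fin using () renaming (_≟_ to _≟ᶠ_)
open import Data.Fin.Properties using (any?)
open import Data.Fin.Subset using (Subset; inside; outside; _∩_; _∪_; ∁; ⊥; ⊤; _⊆_; ∣_∣; Empty)
open import Data.Fin.Subset.Properties
  using (_⊆?_; ∣p∩q∣≤∣p∣; ∣p∩q∣≤∣q∣; ∣∁p∣≡n∸∣p∣; ∣⊥∣≡0; ∣⊤∣≡n; Empty-unique; x∈p∩q⁻; x∈∁p⇒x∉p;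
         p⊆p∪q; q⊆p∪q; ⊆-trans; ∩-comm)
open import Data.Product using (_,_; proj₁; proj₂)
open import Data.Sum using (_⊎_; inj₁; inj₂)
open import Relation.Nullary using (¬_; Dec; yes; no; does)
open import Relation.Nullary.Decidable using (dec-true; dec-false)
open import Relation.Binary.PropositionalEquality renaming (sym to ≡-sym)

private variable
  A B : Set

-- Finite sums over a list, and counting as the sum of an indicator.  With
-- these definitions, `degree G v` is literally `count (adj G v) (allFin n)`.
sumOver : (A → ℕ) → List A → ℕ
sumOver f xs = sum (map f xs)

indicator : (A → Bool) → A → ℕ
indicator p x = if p x then 1 else 0

count : (A → Bool) → List A → ℕ
count p = sumOver (indicator p)

sumOver-mono : {f g : A → ℕ} → (∀ x → f x ≤ g x) → ∀ xs → sumOver f xs ≤ sumOver g xs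
sumOver-mono f≤g []       = z≤n
sumOver-mono f≤g (x ∷ xs) = +-mono-≤ (f≤g x) (sumOver-mono f≤g xs)

sumOver-strict : {f g : A → ℕ} → (∀ x → f x ≤ g x) →
  ∀ {y} xs → y ∈ xs → f y < g y → sumOver f xs < sumOver g xs
sumOver-strict f≤g (x ∷ xs) (here refl) fy<gy = +-mono-<-≤ fy<gy (sumOver-mono f≤g xs)
sumOver-strict f≤g (x ∷ xs) (there y∈xs) fy<gy =
  +-mono-≤-< (f≤g x) (sumOver-strict f≤g xs y∈xs fy<gy)

sumOver-++ : (f : A → ℕ) (xs ys : List A) → sumOver f (xs ++ ys) ≡ sumOver f xs + sumOver f ys
sumOver-++ f xs ys = trans (cong sum (map-++ f xs ys)) (sum-++ (map f xs) (map f ys))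

sumOver-concatMap : (f : B → ℕ) (g : A → List B) (xs : List A) →
  sumOver f (concatMap g xs) ≡ sumOver (λ x → sumOver f (g x)) xs
sumOver-concatMap f g []       = refl
sumOver-concatMap f g (x ∷ xs) =
  trans (sumOver-++ f (g x) (concatMap g xs)) (cong (sumOver f (g x) +_) (sumOver-concatMap f g xs))

sumOver-+ : (f g : A → ℕ) (xs : List A) →
  sumOver (λ x → f x + g x) xs ≡ sumOver f xs + sumOver g xs
sumOver-+ f g []       = refl
sumOver-+ f g (x ∷ xs) rewrite sumOver-+ f g xs = interchange (f x) (g x) _ _
  where
  interchange : ∀ a b c d → a + b + (c + d) ≡ a + c + (b + d)
  interchange = solve-∀

sumOver-if : (p : A → Bool) (c : ℕ) (xs : List A) →
  sumOver (λ x → if p x then c else 0) xs ≡ count p xs * c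
sumOver-if p c []       = refl
sumOver-if p c (x ∷ xs) with p x
... | true  = cong (c +_) (sumOver-if p c xs)
... | false = sumOver-if p c xs

count-cong : {p q : A → Bool} → (∀ x → p x ≡ q x) → ∀ xs → count p xs ≡ count q xs
count-cong p≡q xs = cong sum (map-cong (λ x → cong (λ b → if b then 1 else 0) (p≡q x)) xs)

count-map : (p : B → Bool) (f : A → B) (xs : List A) → count p (map f xs) ≡ count (λ x → p (f x)) xs
count-map p f xs = cong sum (≡-sym (map-∘ xs))

indicator-mono : {p q : A → Bool} → (∀ x → p x ≡ true → q x ≡ true) → ∀ x → indicator p x ≤ indicator q x
indicator-mono {p = p} {q} p⇒q x with p x in px | q x in qx
... | false | _     = z≤n
... | true  | true  = ≤-refl
... | true  | false with () ← trans (≡-sym (p⇒q x px)) qx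

count-mono : {p q : A → Bool} → (∀ x → p x ≡ true → q x ≡ true) → ∀ xs → count p xs ≤ count q xs
count-mono p⇒q = sumOver-mono (indicator-mono p⇒q)

count-strict : {p q : A → Bool} → (∀ x → p x ≡ true → q x ≡ true) →
  ∀ {y} xs → y ∈ xs → p y ≡ false → q y ≡ true → count p xs < count q xs
count-strict {p = p} {q} p⇒q {y} xs y∈xs py qy = sumOver-strict (indicator-mono p⇒q) xs y∈xs indicator<
  where
  indicator< : indicator p y < indicator q y
  indicator< rewrite py | qy = ≤-refl

count-none : {p : A → Bool} → (∀ x → p x ≡ false) → ∀ xs → count p xs ≡ 0
count-none none []       = refl
count-none none (x ∷ xs) rewrite none x = count-none none xs

count-positive : {p : A → Bool} {x : A} → ∀ xs → x ∈ xs → p x ≡ true → 1 ≤ count p xs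
count-positive {p = p} (y ∷ xs) (here refl) py rewrite py = s≤s z≤n
count-positive {p = p} (y ∷ xs) (there x∈) px = ≤-trans (count-positive xs x∈ px) (m≤n+m _ (indicator p y))

count-≤-length : (p : A → Bool) (xs : List A) → count p xs ≤ length xs
count-≤-length p []       = z≤n
count-≤-length p (x ∷ xs) with p x
... | true  = s≤s (count-≤-length p xs)
... | false = m≤n⇒m≤1+n (count-≤-length p xs)

∧-true⁻ : ∀ {a b} → a ∧ b ≡ true → a ≡ true × b ≡ true
∧-true⁻ {true} {true} _ = refl , refl

∧-true⁺ : ∀ {a b} → a ≡ true → b ≡ true → a ∧ b ≡ true
∧-true⁺ refl refl = refl

findTrue : (p : A → Bool) (xs : List A) →
  (∀ x → x ∈ xs → p x ≡ false) ⊎ Σ A (λ x → x ∈ xs × p x ≡ true)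
findTrue p []       = inj₁ (λ x ())
findTrue p (x ∷ xs) with p x in px | findTrue p xs
... | true  | _                   = inj₂ (x , here refl , px)
... | false | inj₂ (y , y∈ , py) = inj₂ (y , there y∈ , py)
... | false | inj₁ none           = inj₁ λ { y (here refl) → px ; y (there y∈) → none y y∈ }

WantedAndFree : {A B : Set} → (A → Bool) → (B → A → Bool) → List B → List A → Set
WantedAndFree {A} wanted violates cs xs =
  Σ A λ x → x ∈ xs × wanted x ≡ true × (∀ c → c ∈ cs → violates c x ≡ false)

weaken-WantedAndFree : {wanted : A → Bool} {violates : B → A → Bool} {cs : List B} {xs : List A} {y : A} →
  WantedAndFree wanted violates cs xs → WantedAndFree wanted violates cs (y ∷ xs)
weaken-WantedAndFree (x , x∈ , wx , free) = x , there x∈ , wx , free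

unionBound : {A B : Set} (wanted : A → Bool) (violates : B → A → Bool) (cs : List B) (xs : List A) →
  sumOver (λ c → count (λ x → wanted x ∧ violates c x) xs) cs < count wanted xs →
  WantedAndFree wanted violates cs xs
unionBound {B = B} wanted violates cs (x ∷ xs) lt with wanted x in wx
... | false = weaken-WantedAndFree (unionBound wanted violates cs xs lt)
... | true with findTrue (λ c → violates c x) cs
...   | inj₁ free = x , here refl , wx , free
...   | inj₂ (c₀ , c₀∈ , c₀x) = weaken-WantedAndFree (unionBound wanted violates cs xs lt′)
  where
  -- constraint c₀ already accounts for x, so the bound persists on xs
  rest : B → ℕ
  rest c = count (λ y → wanted y ∧ violates c y) xs
  rest≤ : ∀ c → rest c ≤ indicator (λ c → violates c x) c + rest c
  rest≤ c = m≤n+m (rest c) _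
  rest< : rest c₀ < indicator (λ c → violates c x) c₀ + rest c₀
  rest< rewrite c₀x = ≤-refl
  lt′ : sumOver rest cs < count wanted xs
  lt′ = ≤-pred (≤-trans (s≤s (sumOver-strict rest≤ cs c₀∈ rest<)) lt)

-- Binomial coefficients by Pascal's rule; the subset counting below is an
-- induction along exactly this recursion.
choose : ℕ → ℕ → ℕ
choose n       zero    = 1
choose zero    (suc k) = 0
choose (suc n) (suc k) = choose n k + choose n (suc k)

choose-mono : ∀ {n m} k → n ≤ m → choose n k ≤ choose m k
choose-mono {n} {m} k n≤m = subst (λ m → choose n k ≤ choose m k) (m∸n+n≡m n≤m) (grow (m ∸ n))
  where
  addPoint : ∀ n k → choose n k ≤ choose (suc n) k
  addPoint n zero    = ≤-refl
  addPoint n (suc k) = m≤n+m (choose n (suc k)) (choose n k)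
  grow : ∀ d → choose n k ≤ choose (d + n) k
  grow zero    = ≤-refl
  grow (suc d) = ≤-trans (grow d) (addPoint (d + n) k)

choose-vanishes : ∀ n k → n < k → choose n k ≡ 0
choose-vanishes zero    (suc k) n<k       = refl
choose-vanishes (suc n) (suc k) (s≤s n<k)
  rewrite choose-vanishes n k n<k | choose-vanishes n (suc k) (m≤n⇒m≤1+n n<k) = refl

choose-positive : ∀ n k → k ≤ n → 1 ≤ choose n k
choose-positive n       zero    k≤n       = ≤-refl
choose-positive (suc n) (suc k) (s≤s k≤n) = ≤-trans (choose-positive n k k≤n) (m≤m+n (choose n k) _)

choose-one : ∀ n → choose n 1 ≡ n
choose-one zero    = refl
choose-one (suc n) = cong suc (choose-one n)

choose-absorption : ∀ n k → choose (suc n) (suc k) * suc k ≡ choose n k * suc n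
choose-absorption n       zero    rewrite choose-one n = *-comm (suc n) 1
choose-absorption zero    (suc k) = refl
choose-absorption (suc n) (suc k) = begin
  (X + choose (suc n) (suc (suc k))) * suc (suc k)
    ≡⟨ split X (choose (suc n) (suc (suc k))) (suc k) ⟩
  X + X * suc k + choose (suc n) (suc (suc k)) * suc (suc k)
    ≡⟨ cong₂ (λ a b → X + a + b) (choose-absorption n k) (choose-absorption n (suc k)) ⟩
  X + choose n k * suc n + choose n (suc k) * suc n
    ≡⟨ merge (choose n k) (choose n (suc k)) (suc n) ⟩
  X * suc (suc n) ∎
  where
  open ≡-Reasoning
  X : ℕ
  X = choose (suc n) (suc k)
  split : ∀ x y k → (x + y) * suc k ≡ x + x * k + y * suc k
  split = solve-∀
  merge : ∀ a b m → (a + b) + a * m + b * m ≡ (a + b) * suc m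
  merge = solve-∀

choose-falling : ∀ t j → choose t j * j ! ≤ t ^ j
choose-falling t       zero    = ≤-refl
choose-falling zero    (suc j) = z≤n
choose-falling (suc t) (suc j) = begin
  choose (suc t) (suc j) * (suc j * j !) ≡⟨ ≡-sym (*-assoc (choose (suc t) (suc j)) (suc j) (j !)) ⟩
  choose (suc t) (suc j) * suc j * j !   ≡⟨ cong (_* j !) (choose-absorption t j) ⟩
  choose t j * suc t * j !               ≡⟨ rearrange (choose t j) (suc t) (j !) ⟩
  suc t * (choose t j * j !)             ≤⟨ *-monoʳ-≤ (suc t) (choose-falling t j) ⟩
  suc t * t ^ j                          ≤⟨ *-monoʳ-≤ (suc t) (^-monoˡ-≤ j (n≤1+n t)) ⟩
  suc t * suc t ^ j                      ∎
  where
  open ≤-Reasoning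
  rearrange : ∀ a b c → a * b * c ≡ b * (a * c)
  rearrange = solve-∀

-- Induction on j, one factor (b+1)/(s+1) at a time.
choose-ratio : ∀ j b s → s ≤ b → choose b s * (j + b) ^ j ≤ choose (j + b) (j + s) * (j + s) ^ j
choose-ratio zero    b s s≤b = ≤-refl
choose-ratio (suc j) b s s≤b = *-cancelʳ-≤ _ _ (suc b) scaled
  where
  open ≤-Reasoning
  B′ S′ : ℕ
  B′ = suc (j + b)
  S′ = suc (j + s)
  shifted : choose (suc b) (suc s) * B′ ^ j ≤ choose B′ S′ * S′ ^ j
  shifted = subst₂ (λ x y → choose (suc b) (suc s) * x ^ j ≤ choose x y * y ^ j) (+-suc j b) (+-suc j s)
              (choose-ratio j (suc b) (suc s) (s≤s s≤b))
  factor : suc s * B′ ≤ S′ * suc b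
  factor = begin
    suc s * B′                  ≡⟨ l s j b ⟩
    suc s * suc b + suc s * j   ≤⟨ +-monoʳ-≤ (suc s * suc b) (*-monoˡ-≤ j (s≤s s≤b)) ⟩
    suc s * suc b + suc b * j   ≡⟨ ≡-sym (r s j b) ⟩
    S′ * suc b                  ∎
    where
    l : ∀ s j b → suc s * suc (j + b) ≡ suc s * suc b + suc s * j
    l = solve-∀
    r : ∀ s j b → suc (j + s) * suc b ≡ suc s * suc b + suc b * j
    r = solve-∀
  scaled : choose b s * (B′ * B′ ^ j) * suc b ≤ choose B′ S′ * (S′ * S′ ^ j) * suc b
  scaled = begin
    choose b s * (B′ * B′ ^ j) * suc b           ≡⟨ e₁ (choose b s) B′ (B′ ^ j) (suc b) ⟩
    choose b s * suc b * B′ * B′ ^ j             ≡⟨ cong (λ z → z * B′ * B′ ^ j) (≡-sym (choose-absorption b s)) ⟩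
    choose (suc b) (suc s) * suc s * B′ * B′ ^ j ≡⟨ e₂ (choose (suc b) (suc s)) (suc s) B′ (B′ ^ j) ⟩
    (choose (suc b) (suc s) * B′ ^ j) * (suc s * B′) ≤⟨ *-mono-≤ shifted factor ⟩
    (choose B′ S′ * S′ ^ j) * (S′ * suc b)       ≡⟨ e₃ (choose B′ S′) (S′ ^ j) S′ (suc b) ⟩
    choose B′ S′ * (S′ * S′ ^ j) * suc b         ∎
    where
    e₁ : ∀ c a p q → c * (a * p) * q ≡ c * q * a * p
    e₁ = solve-∀
    e₂ : ∀ c s a p → c * s * a * p ≡ (c * p) * (s * a)
    e₂ = solve-∀
    e₃ : ∀ c p t q → (c * p) * (t * q) ≡ c * (t * p) * q
    e₃ = solve-∀

choose-shrink : ∀ j t a → j ≤ t → t ≤ a → choose (a ∸ j) (t ∸ j) * a ^ j ≤ choose a t * t ^ j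
choose-shrink j t a j≤t t≤a =
  subst₂ (λ x y → choose (a ∸ j) (t ∸ j) * x ^ j ≤ choose x y * y ^ j)
    (m+[n∸m]≡n (≤-trans j≤t t≤a)) (m+[n∸m]≡n j≤t)
    (choose-ratio j (a ∸ j) (t ∸ j) (∸-monoˡ-≤ j t≤a))

-- Structural Boolean `m ≤ n`.  Unlike the builtin `_≤ᵇ_`, `leq (suc m) (suc n)`
-- reduces to `leq m n`, which the counting inductions below rely on.
leq : ℕ → ℕ → Bool
leq zero    n       = true
leq (suc m) zero    = false
leq (suc m) (suc n) = leq m n

leq-sound : ∀ m n → leq m n ≡ true → m ≤ n
leq-sound zero    n       _ = z≤n
leq-sound (suc m) (suc n) e = s≤s (leq-sound m n e)

leq-complete : ∀ {m n} → m ≤ n → leq m n ≡ true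
leq-complete z≤n       = refl
leq-complete (s≤s m≤n) = leq-complete m≤n

leq-false : ∀ m n → leq m n ≡ false → n < m
leq-false (suc m) zero    e = s≤s z≤n
leq-false (suc m) (suc n) e = s≤s (leq-false m n e)

leq-false-intro : ∀ m n → n < m → leq m n ≡ false
leq-false-intro (suc m) zero    _         = refl
leq-false-intro (suc m) (suc n) (s≤s n<m) = leq-false-intro m n n<m

-- All t-element subsets of an n-element set, listed without repetition.
subsetsOfSize : (n t : ℕ) → List (Subset n)
subsetsOfSize zero    zero    = [] ∷ []
subsetsOfSize zero    (suc t) = []
subsetsOfSize (suc n) zero    = map (outside ∷_) (subsetsOfSize n zero)
subsetsOfSize (suc n) (suc t) = map (outside ∷_) (subsetsOfSize n (suc t)) ++ map (inside ∷_) (subsetsOfSize n t)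

subsetsOfSize-card : ∀ n t {S : Subset n} → S ∈ subsetsOfSize n t → ∣ S ∣ ≡ t
subsetsOfSize-card zero    zero    (here refl) = refl
subsetsOfSize-card (suc n) zero    S∈ with ∈-map⁻ (outside ∷_) S∈
... | _ , S′∈ , refl = subsetsOfSize-card n zero S′∈
subsetsOfSize-card (suc n) (suc t) S∈ with ∈-++⁻ (map (outside ∷_) (subsetsOfSize n (suc t))) S∈
... | inj₁ S∈₁ with ∈-map⁻ (outside ∷_) S∈₁
...   | _ , S′∈ , refl = subsetsOfSize-card n (suc t) S′∈
subsetsOfSize-card (suc n) (suc t) S∈ | inj₂ S∈₂ with ∈-map⁻ (inside ∷_) S∈₂
...   | _ , S′∈ , refl = cong suc (subsetsOfSize-card n t S′∈)

within : ∀ {n} → Subset n → Subset n → Bool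
within m S = does (S ⊆? m)

within-sound : ∀ {n} {m S : Subset n} → within m S ≡ true → S ⊆ m
within-sound {m = m} {S} e with S ⊆? m
... | yes S⊆m = S⊆m
... | no  _   with () ← e

count-within : ∀ n (m : Subset n) t → count (within m) (subsetsOfSize n t) ≡ choose (∣ m ∣) t
count-within zero    []      zero    = refl
count-within zero    []      (suc t) = refl
count-within (suc n) (y ∷ m) zero    =
  trans (count-map (within (y ∷ m)) (outside ∷_) (subsetsOfSize n zero)) (count-within n m zero)
count-within (suc n) (y ∷ m) (suc t) = begin
  count (within (y ∷ m)) (map (outside ∷_) Ls ++ map (inside ∷_) Rs)
    ≡⟨ sumOver-++ (indicator (within (y ∷ m))) (map (outside ∷_) Ls) _ ⟩
  count (within (y ∷ m)) (map (outside ∷_) Ls) + count (within (y ∷ m)) (map (inside ∷_) Rs)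
    ≡⟨ cong₂ _+_ (count-map _ (outside ∷_) Ls) (count-map _ (inside ∷_) Rs) ⟩
  count (within m) Ls + count (λ S → within (y ∷ m) (inside ∷ S)) Rs
    ≡⟨ cong (_+ count (λ S → within (y ∷ m) (inside ∷ S)) Rs) (count-within n m (suc t)) ⟩
  choose (∣ m ∣) (suc t) + count (λ S → within (y ∷ m) (inside ∷ S)) Rs
    ≡⟨ pascal y ⟩
  choose (∣ y ∷ m ∣) (suc t) ∎
  where
  open ≡-Reasoning
  Ls Rs : List (Subset n)
  Ls = subsetsOfSize n (suc t)
  Rs = subsetsOfSize n t
  -- a new point outside m adds nothing; one inside m gives Pascal's rule
  pascal : ∀ y → choose (∣ m ∣) (suc t) + count (λ S → within (y ∷ m) (inside ∷ S)) Rs ≡ choose (∣ y ∷ m ∣) (suc t)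
  pascal outside = trans (cong (choose (∣ m ∣) (suc t) +_) (count-none (λ _ → refl) Rs)) (+-identityʳ _)
  pascal inside  = trans (cong (choose (∣ m ∣) (suc t) +_) (count-within n m t)) (+-comm (choose (∣ m ∣) (suc t)) _)

-- Bound on the number of t-subsets of a b-element palette meeting a fixed
-- p-element part of it in at least j points: choose j of the p points, then
-- the remaining t-j points among the other b-j (zero if j > t).
overlapBound : ℕ → ℕ → ℕ → ℕ → ℕ
overlapBound p b t j = if leq j t then choose p j * choose (b ∸ j) (t ∸ j) else 0

overlapBound-≤ : ∀ p b t j → p ≤ t → overlapBound p b t j ≤ choose t j * choose (b ∸ j) (t ∸ j)
overlapBound-≤ p b t j p≤t with leq j t
... | true  = *-monoˡ-≤ (choose (b ∸ j) (t ∸ j)) (choose-mono j p≤t)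
... | false = z≤n

-- The two Pascal-type inequalities satisfied by overlapBound: a new palette
-- point outside, resp. inside, the fixed part.
overlapBound-outside : ∀ p b t j → p ≤ b →
  overlapBound p b (suc t) (suc j) + overlapBound p b t (suc j) ≤ overlapBound p (suc b) (suc t) (suc j)
overlapBound-outside p b t j p≤b with leq j t in j≤t | leq (suc j) t in j<t
... | false | true  = ⊥-elim (<-asym (leq-false j t j≤t) (leq-sound (suc j) t j<t))
... | false | false = z≤n
... | true  | false =
  ≤-trans (≤-reflexive (+-identityʳ _))
          (*-monoʳ-≤ (choose p (suc j)) (choose-mono (t ∸ j) (∸-monoʳ-≤ b (n≤1+n j))))
... | true  | true with j <? b
...   | no j≮b rewrite choose-vanishes p (suc j) (s≤s (≤-trans p≤b (≮⇒≥ j≮b))) = z≤n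
...   | yes j<b = ≤-reflexive (begin
  P * choose x (t ∸ j) + P * choose x c ≡⟨ cong (λ z → P * choose x z + P * choose x c) (+-∸-assoc 1 (leq-sound (suc j) t j<t)) ⟩
  P * choose x (suc c) + P * choose x c ≡⟨ ≡-sym (*-distribˡ-+ P (choose x (suc c)) (choose x c)) ⟩
  P * (choose x (suc c) + choose x c)   ≡⟨ cong (P *_) (+-comm (choose x (suc c)) (choose x c)) ⟩
  P * choose (suc x) (suc c)            ≡⟨ cong₂ (λ u v → P * choose u v) (≡-sym (+-∸-assoc 1 j<b)) (≡-sym (+-∸-assoc 1 (leq-sound (suc j) t j<t))) ⟩
  P * choose (b ∸ j) (t ∸ j)            ∎)
  where
  open ≡-Reasoning
  P x c : ℕ
  P = choose p (suc j)
  x = b ∸ suc j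
  c = t ∸ suc j

overlapBound-inside : ∀ p b t j →
  overlapBound p b (suc t) (suc j) + overlapBound p b t j ≤ overlapBound (suc p) (suc b) (suc t) (suc j)
overlapBound-inside p b t j with leq j t
... | false = z≤n
... | true  = begin
  choose p (suc j) * choose (b ∸ suc j) (t ∸ j) + choose p j * Y
    ≤⟨ +-monoˡ-≤ (choose p j * Y) (*-monoʳ-≤ (choose p (suc j)) (choose-mono (t ∸ j) (∸-monoʳ-≤ b (n≤1+n j)))) ⟩
  choose p (suc j) * Y + choose p j * Y ≡⟨ ≡-sym (*-distribʳ-+ Y (choose p (suc j)) (choose p j)) ⟩
  (choose p (suc j) + choose p j) * Y   ≡⟨ cong (_* Y) (+-comm (choose p (suc j)) (choose p j)) ⟩
  (choose p j + choose p (suc j)) * Y   ∎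
  where
  open ≤-Reasoning
  Y : ℕ
  Y = choose (b ∸ j) (t ∸ j)

overlapsIn : ℕ → ∀ {n} → Subset n → Subset n → Bool
overlapsIn j F S = leq j ∣ S ∩ F ∣

count-overlapping : ∀ n (m F : Subset n) t j →
  count (λ S → within m S ∧ overlapsIn j F S) (subsetsOfSize n t) ≤ overlapBound (∣ F ∩ m ∣) (∣ m ∣) t j
count-overlapping n m F t zero = ≤-reflexive (begin
  count (λ S → within m S ∧ true) (subsetsOfSize n t) ≡⟨ count-cong (λ S → ∧-identityʳ (within m S)) (subsetsOfSize n t) ⟩
  count (within m) (subsetsOfSize n t)                ≡⟨ count-within n m t ⟩
  choose (∣ m ∣) t                                    ≡⟨ ≡-sym (+-identityʳ _) ⟩
  overlapBound (∣ F ∩ m ∣) (∣ m ∣) t zero             ∎)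
  where open ≡-Reasoning
count-overlapping zero    []      []      zero    (suc j) = z≤n
count-overlapping zero    []      []      (suc t) (suc j) = z≤n
count-overlapping (suc n) (y ∷ m) (z ∷ F) zero    (suc j) =
  ≤-trans (≤-reflexive (count-map _ (outside ∷_) (subsetsOfSize n zero))) (count-overlapping n m F zero (suc j))
count-overlapping (suc n) (y ∷ m) (z ∷ F) (suc t) (suc j) =
  ≤-trans (≤-reflexive (trans (sumOver-++ _ (map (outside ∷_) Ls) _)
                              (cong₂ _+_ (count-map _ (outside ∷_) Ls) (count-map _ (inside ∷_) Rs))))
          (byHeads y z)
  where
  Ls Rs : List (Subset n)
  Ls = subsetsOfSize n (suc t)
  Rs = subsetsOfSize n t
  withoutHead : count (λ S → within m S ∧ overlapsIn (suc j) F S) Ls ≤ overlapBound (∣ F ∩ m ∣) (∣ m ∣) (suc t) (suc j)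
  withoutHead = count-overlapping n m F (suc t) (suc j)
  drop-zero : ∀ {a b} → b ≡ 0 → a + b ≤ a
  drop-zero {a} refl = ≤-reflexive (+-identityʳ a)
  byHeads : ∀ y z →
    count (λ S → within (y ∷ m) (outside ∷ S) ∧ overlapsIn (suc j) (z ∷ F) (outside ∷ S)) Ls
      + count (λ S → within (y ∷ m) (inside ∷ S) ∧ overlapsIn (suc j) (z ∷ F) (inside ∷ S)) Rs
      ≤ overlapBound (∣ (z ∷ F) ∩ (y ∷ m) ∣) (∣ y ∷ m ∣) (suc t) (suc j)
  byHeads outside outside = ≤-trans (drop-zero (count-none (λ _ → refl) Rs)) withoutHead
  byHeads outside inside  = ≤-trans (drop-zero (count-none (λ _ → refl) Rs)) withoutHead
  byHeads inside  outside =
    ≤-trans (+-mono-≤ withoutHead (count-overlapping n m F t (suc j)))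
            (overlapBound-outside _ _ t j (∣p∩q∣≤∣q∣ F m))
  byHeads inside  inside  =
    ≤-trans (+-mono-≤ withoutHead (count-overlapping n m F t j)) (overlapBound-inside _ _ t j)

∣p∪q∣≤∣p∣+∣q∣ : ∀ {n} (p q : Subset n) → ∣ p ∪ q ∣ ≤ ∣ p ∣ + ∣ q ∣
∣p∪q∣≤∣p∣+∣q∣ []            []            = z≤n
∣p∪q∣≤∣p∣+∣q∣ (outside ∷ p) (outside ∷ q) = ∣p∪q∣≤∣p∣+∣q∣ p q
∣p∪q∣≤∣p∣+∣q∣ (outside ∷ p) (inside  ∷ q) = ≤-trans (s≤s (∣p∪q∣≤∣p∣+∣q∣ p q)) (≤-reflexive (≡-sym (+-suc ∣ p ∣ ∣ q ∣)))
∣p∪q∣≤∣p∣+∣q∣ (inside  ∷ p) (outside ∷ q) = s≤s (∣p∪q∣≤∣p∣+∣q∣ p q)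
∣p∪q∣≤∣p∣+∣q∣ (inside  ∷ p) (inside  ∷ q) = s≤s (≤-trans (∣p∪q∣≤∣p∣+∣q∣ p q) (≤-trans (n≤1+n _) (≤-reflexive (≡-sym (+-suc ∣ p ∣ ∣ q ∣)))))

disjoint : ∀ {n} {p q B : Subset n} → p ⊆ ∁ B → q ⊆ B → ∣ p ∩ q ∣ ≡ 0
disjoint {n} {p} {q} p⊆∁B q⊆B = trans (cong ∣_∣ (Empty-unique noCommon)) (∣⊥∣≡0 n)
  where
  noCommon : Empty (p ∩ q)
  noCommon (x , x∈p∩q) with x∈p∩q⁻ p q x∈p∩q
  ... | x∈p , x∈q = x∈∁p⇒x∉p (p⊆∁B x∈p) (q⊆B x∈q)

^-distribʳ-* : ∀ m n j → (m * n) ^ j ≡ m ^ j * n ^ j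
^-distribʳ-* m n zero    = refl
^-distribʳ-* m n (suc j) rewrite ^-distribʳ-* m n j = swap m n (m ^ j) (n ^ j)
  where
  swap : ∀ m n a b → m * n * (a * b) ≡ m * a * (n * b)
  swap = solve-∀

integerRoot : ∀ X t → 1 ≤ t → Σ ℕ λ M → M ^ t ≤ X × X < suc M ^ t
integerRoot X t@(suc t′) _ = search X 0 (≤-reflexive (≡-sym (+-identityʳ X))) z≤n
  where
  grows : ∀ M → suc M ≤ suc M ^ t
  grows M = ≤-trans (≤-reflexive (≡-sym (*-identityʳ (suc M))))
                    (*-monoʳ-≤ (suc M) (^-monoʳ-≤ (suc M) {0} {t′} z≤n))
  -- invariant: M^t ≤ X, and X ≤ fuel + M bounds the remaining search
  search : ∀ fuel M → X ≤ fuel + M → M ^ t ≤ X → Σ ℕ λ M → M ^ t ≤ X × X < suc M ^ t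
  search fuel M X≤ M^t≤X with suc M ^ t ≤? X
  ... | no  ≰X = M , M^t≤X , ≰⇒> ≰X
  search zero       M X≤ M^t≤X | yes ≤X = ⊥-elim (<-irrefl refl (≤-trans (s≤s X≤) (≤-trans (grows M) ≤X)))
  search (suc fuel) M X≤ M^t≤X | yes ≤X = search fuel (suc M) (≤-trans X≤ (≤-reflexive (≡-sym (+-suc fuel M)))) ≤X

-- If A^t·r^(t-1) < y^t then A^j·r^(j-1) ≤ y^j for every 1 ≤ j ≤ t (here
-- j = i+1, t = j+d).  Either y > A·r and the claim is immediate, or
-- y ≤ A·r and a failure at j would multiply up to a failure at t.
powerBound-descends : ∀ A r y i d → 1 ≤ A → 1 ≤ r →
  A ^ (suc i + d) * r ^ (i + d) < y ^ (suc i + d) → A ^ suc i * r ^ i ≤ y ^ suc i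
powerBound-descends A r y i d 1≤A 1≤r below with y ≤? A * r
... | no y≰Ar = begin
  A ^ suc i * r ^ i     ≤⟨ *-monoʳ-≤ (A ^ suc i) (≤-trans (≤-reflexive (≡-sym (*-identityˡ (r ^ i)))) (*-monoˡ-≤ (r ^ i) 1≤r)) ⟩
  A ^ suc i * r ^ suc i ≡⟨ ≡-sym (^-distribʳ-* A r (suc i)) ⟩
  (A * r) ^ suc i       ≤⟨ ^-monoˡ-≤ (suc i) (<⇒≤ (≰⇒> y≰Ar)) ⟩
  y ^ suc i             ∎
  where open ≤-Reasoning
... | yes y≤Ar with A ^ suc i * r ^ i ≤? y ^ suc i
...   | yes ok = ok
...   | no fails = ⊥-elim (<-asym below above)
  where
  open ≤-Reasoning
  Q : ℕ
  Q = (A * r) ^ d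
  instance
    Q≢0 : NonZero Q
    Q≢0 = >-nonZero (≤-trans (≤-reflexive (≡-sym (^-zeroˡ d)))
                      (^-monoˡ-≤ d (≤-trans 1≤A (≤-trans (≤-reflexive (≡-sym (*-identityʳ A))) (*-monoʳ-≤ A 1≤r)))))
  above : y ^ (suc i + d) < A ^ (suc i + d) * r ^ (i + d)
  above = begin-strict
    y ^ (suc i + d)                     ≡⟨ ^-distribˡ-+-* y (suc i) d ⟩
    y ^ suc i * y ^ d                   ≤⟨ *-monoʳ-≤ (y ^ suc i) (^-monoˡ-≤ d y≤Ar) ⟩
    y ^ suc i * Q                       <⟨ *-monoˡ-< Q (≰⇒> fails) ⟩
    A ^ suc i * r ^ i * Q               ≡⟨ cong (A ^ suc i * r ^ i *_) (^-distribʳ-* A r d) ⟩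
    A ^ suc i * r ^ i * (A ^ d * r ^ d) ≡⟨ interchange (A ^ suc i) (r ^ i) (A ^ d) (r ^ d) ⟩
    (A ^ suc i * A ^ d) * (r ^ i * r ^ d) ≡⟨ ≡-sym (cong₂ _*_ (^-distribˡ-+-* A (suc i) d) (^-distribˡ-+-* r i d)) ⟩
    A ^ (suc i + d) * r ^ (i + d)       ∎
    where
    interchange : ∀ a b c e → a * b * (c * e) ≡ (a * c) * (b * e)
    interchange = solve-∀

-- The recursion k·r^j + r·(j·k·r^(j-1)) = (j+1)·k·r^j behind the walk count
-- j·k·r^(j-1).
walkBound-step : ∀ k r j → k * r ^ j + r * (j * k * r ^ (j ∸ 1)) ≡ suc j * k * r ^ j
walkBound-step k r zero    = e₀ k r
  where
  e₀ : ∀ k r → k * 1 + r * 0 ≡ (k + 0) * 1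
  e₀ = solve-∀
walkBound-step k r (suc j) = e k r (r ^ j) j
  where
  e : ∀ k r x j → k * (r * x) + r * (suc j * k * x) ≡ suc (suc j) * k * (r * x)
  e = solve-∀

interval : ℕ → ℕ → List ℕ
interval lo zero    = []
interval lo (suc c) = lo ∷ interval (suc lo) c

∈-interval : ∀ lo c j → lo ≤ j → j < lo + c → j ∈ interval lo c
∈-interval lo zero    j lo≤j j<lo = ⊥-elim (<-irrefl refl (≤-trans j<lo (≤-trans (≤-reflexive (+-identityʳ lo)) lo≤j)))
∈-interval lo (suc c) j lo≤j j<lo+c with lo ≟ j
... | yes refl = here refl
... | no  lo≢j = there (∈-interval (suc lo) c j (≤∧≢⇒< lo≤j lo≢j) (≤-trans j<lo+c (≤-reflexive (+-suc lo c))))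

-- Weight of distance level j in the union bound of the extension step: at
-- most j·k·r^(j-1) earlier vertices lie at the end of a walk of length j, and
-- each rules out at most C(t,j)·C(a-j,t-j) of the t-subsets of an a-element
-- palette.
levelWeight : ℕ → ℕ → ℕ → ℕ → ℕ → ℕ
levelWeight k r t a j = j * k * r ^ (j ∸ 1) * (choose t j * choose (a ∸ j) (t ∸ j))

-- The numeric fact behind the geometric decay of the level weights.
decay : ∀ m → 9 ^ (3 + m) * 5 ^ (1 + m) ≤ (2 + m) ! * 2 ^ (2 + m) * 8 ^ (3 + m)
decay zero    = ≤ᵇ⇒≤ 3645 4096 tt
decay (suc m) = begin
  9 ^ (4 + m) * 5 ^ (2 + m)                   ≡⟨ e₁ (9 ^ (3 + m)) (5 ^ (1 + m)) ⟩
  45 * (9 ^ (3 + m) * 5 ^ (1 + m))            ≤⟨ *-mono-≤ (≤-trans (≤ᵇ⇒≤ 45 48 tt) (*-monoʳ-≤ 16 (m≤n+m 3 m))) (decay m) ⟩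
  (16 * (m + 3)) * ((2 + m) ! * 2 ^ (2 + m) * 8 ^ (3 + m))
                                              ≡⟨ e₂ m ((2 + m) !) (2 ^ (2 + m)) (8 ^ (3 + m)) ⟩
  (3 + m) ! * 2 ^ (3 + m) * 8 ^ (4 + m)       ∎
  where
  open ≤-Reasoning
  e₁ : ∀ a b → 9 * a * (5 * b) ≡ 45 * (a * b)
  e₁ = solve-∀
  e₂ : ∀ m f p e → (16 * (m + 3)) * (f * p * e) ≡ (suc (suc (suc m)) * f) * (2 * p) * (8 * e)
  e₂ = solve-∀

8[a+1]≤9a : ∀ {a} → 8 ≤ a → 8 * suc a ≤ 9 * a
8[a+1]≤9a {a} 8≤a = begin
  8 * suc a ≡⟨ l a ⟩
  8 * a + 8 ≤⟨ +-monoʳ-≤ (8 * a) 8≤a ⟩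
  8 * a + a ≡⟨ ≡-sym (r a) ⟩
  9 * a     ∎
  where
  open ≤-Reasoning
  l : ∀ a → 8 * suc a ≡ 8 * a + 8
  l = solve-∀
  r : ∀ a → 9 * a ≡ 8 * a + a
  r = solve-∀

module LevelWeights (k r t a : ℕ) (2≤k : 2 ≤ k) (t≤a : t ≤ a) (8≤a : 8 ≤ a)
  (large : ∀ i → suc i ≤ t → (k * (t * t)) ^ suc i * r ^ i ≤ suc a ^ suc i) where

  C : ℕ
  C = choose a t
  W : ℕ → ℕ
  W = levelWeight k r t a

  weight-bound : ∀ i → suc i ≤ t → W (suc i) * (i ! * 2 ^ i * 8 ^ suc i) ≤ 9 ^ suc i * C
  weight-bound i j≤t = *-cancelʳ-≤ _ _ (j * a ^ j) {{j*a^j≢0}} scaled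
    where
    open ≤-Reasoning
    j R c D : ℕ
    j = suc i
    R = r ^ i
    c = choose t j
    D = choose (a ∸ j) (t ∸ j)
    j*a^j≢0 : NonZero (j * a ^ j)
    j*a^j≢0 = >-nonZero (*-mono-≤ {1} {j} (s≤s z≤n)
                (≤-trans (≤-reflexive (≡-sym (^-zeroˡ j))) (^-monoˡ-≤ j (≤-trans (s≤s z≤n) 8≤a))))
    kt²-power : (k * k ^ i) * (t ^ j * t ^ j) ≡ (k * (t * t)) ^ j
    kt²-power = trans (cong ((k * k ^ i) *_) (≡-sym (^-distribʳ-* t t j))) (≡-sym (^-distribʳ-* k (t * t) j))
    e₁ : ∀ j k R c D f p e A → j * k * R * (c * D) * (f * p * e) * (j * A) ≡ (k * R * p * j * e) * ((c * (j * f)) * (D * A))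
    e₁ = solve-∀
    e₂ : ∀ k R K j e T C → (k * R * K * j * e) * (T * (C * T)) ≡ (j * C * e) * ((k * K) * (T * T) * R)
    e₂ = solve-∀
    e₃ : ∀ j C N A → j * C * N * A ≡ j * C * (N * A)
    e₃ = solve-∀
    e₄ : ∀ j C N A → j * C * (N * A) ≡ N * C * (j * A)
    e₄ = solve-∀
    scaled : W j * (i ! * 2 ^ i * 8 ^ j) * (j * a ^ j) ≤ 9 ^ j * C * (j * a ^ j)
    scaled = begin
      W j * (i ! * 2 ^ i * 8 ^ j) * (j * a ^ j)
        ≡⟨ e₁ j k R c D (i !) (2 ^ i) (8 ^ j) (a ^ j) ⟩
      (k * R * 2 ^ i * j * 8 ^ j) * ((c * j !) * (D * a ^ j))
        ≤⟨ *-mono-≤ (*-monoˡ-≤ (8 ^ j) (*-monoˡ-≤ j (*-monoʳ-≤ (k * R) (^-monoˡ-≤ i 2≤k))))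
                    (*-mono-≤ (choose-falling t j) (choose-shrink j t a j≤t t≤a)) ⟩
      (k * R * k ^ i * j * 8 ^ j) * (t ^ j * (C * t ^ j))
        ≡⟨ e₂ k R (k ^ i) j (8 ^ j) (t ^ j) C ⟩
      (j * C * 8 ^ j) * ((k * k ^ i) * (t ^ j * t ^ j) * R)
        ≡⟨ cong (λ z → (j * C * 8 ^ j) * (z * R)) kt²-power ⟩
      (j * C * 8 ^ j) * ((k * (t * t)) ^ j * R)
        ≤⟨ *-monoʳ-≤ (j * C * 8 ^ j) (large i j≤t) ⟩
      (j * C * 8 ^ j) * suc a ^ j
        ≡⟨ trans (e₃ j C (8 ^ j) (suc a ^ j)) (cong (j * C *_) (≡-sym (^-distribʳ-* 8 (suc a) j))) ⟩
      j * C * (8 * suc a) ^ j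
        ≤⟨ *-monoʳ-≤ (j * C) (^-monoˡ-≤ j (8[a+1]≤9a 8≤a)) ⟩
      j * C * (9 * a) ^ j
        ≡⟨ trans (cong (j * C *_) (^-distribʳ-* 9 a j)) (e₄ j C (9 ^ j) (a ^ j)) ⟩
      9 ^ j * C * (j * a ^ j) ∎

  tail-weight : ∀ m → 3 + m ≤ t → 5 ^ (1 + m) * W (3 + m) ≤ C
  tail-weight m 3+m≤t = *-cancelʳ-≤ _ _ X {{X≢0}} (begin
    5 ^ (1 + m) * W (3 + m) * X         ≡⟨ *-assoc (5 ^ (1 + m)) _ X ⟩
    5 ^ (1 + m) * (W (3 + m) * X)       ≤⟨ *-monoʳ-≤ (5 ^ (1 + m)) (weight-bound (2 + m) 3+m≤t) ⟩
    5 ^ (1 + m) * (9 ^ (3 + m) * C)     ≡⟨ swap (5 ^ (1 + m)) (9 ^ (3 + m)) C ⟩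
    (9 ^ (3 + m) * 5 ^ (1 + m)) * C     ≤⟨ *-monoˡ-≤ C (decay m) ⟩
    X * C                               ≡⟨ *-comm X C ⟩
    C * X                               ∎)
    where
    open ≤-Reasoning
    X : ℕ
    X = (2 + m) ! * 2 ^ (2 + m) * 8 ^ (3 + m)
    X≢0 : NonZero X
    X≢0 = >-nonZero (*-mono-≤ (*-mono-≤ (1≤n! (2 + m)) (^-monoʳ-≤ 2 {0} {2 + m} z≤n)) (^-monoʳ-≤ 8 {0} {3 + m} z≤n))
    swap : ∀ a b c → a * (b * c) ≡ (b * a) * c
    swap = solve-∀

  tail-sum : ∀ c m → 3 + m + c ≤ suc t → 4 * 5 ^ (1 + m) * sumOver W (interval (3 + m) c) ≤ 5 * C
  tail-sum zero    m _     = ≤-trans (≤-reflexive (*-zeroʳ (4 * 5 ^ (1 + m)))) z≤n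
  tail-sum (suc c) m range = begin
    4 * 5 ^ (1 + m) * (W (3 + m) + rest)          ≡⟨ split (5 ^ (1 + m)) (W (3 + m)) rest ⟩
    4 * (5 ^ (1 + m) * W (3 + m)) + 4 * 5 ^ (1 + m) * rest
                                                  ≤⟨ +-mono-≤ (*-monoʳ-≤ 4 (tail-weight m 3+m≤t)) rest-bound ⟩
    4 * C + C                                     ≡⟨ +-comm (4 * C) C ⟩
    5 * C                                         ∎
    where
    open ≤-Reasoning
    rest = sumOver W (interval (4 + m) c)
    range′ : 3 + suc m + c ≤ suc t
    range′ = ≤-trans (≤-reflexive (≡-sym (+-suc (3 + m) c))) range
    3+m≤t : 3 + m ≤ t
    3+m≤t = ≤-pred (≤-trans (s≤s (m≤m+n (3 + m) c)) range′)
    split : ∀ p x s → 4 * p * (x + s) ≡ 4 * (p * x) + 4 * p * s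
    split = solve-∀
    five : ∀ p s → 4 * (5 * p) * s ≡ 5 * (4 * p * s)
    five = solve-∀
    rest-bound : 4 * 5 ^ (1 + m) * rest ≤ C
    rest-bound = *-cancelˡ-≤ 5 (≤-trans (≤-reflexive (≡-sym (five (5 ^ (1 + m)) rest))) (tail-sum c (suc m) range′))

  -- For t ≥ 2: Σ_{j=2}^{t} W(j) ≤ (81/128 + 1/4)·C < C.
  weights<choose : ∀ t″ → t ≡ suc (suc t″) → sumOver W (interval 2 (suc t″)) < C
  weights<choose t″ refl = *-cancelʳ-< _ (sumOver W (interval 2 (suc t″))) C (begin-strict
    (W 2 + rest) * 128              ≡⟨ *-distribʳ-+ 128 (W 2) rest ⟩
    W 2 * 128 + rest * 128          ≡⟨ cong (W 2 * 128 +_) (e₁ rest) ⟩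
    W 2 * 128 + 32 * (4 * rest)     ≤⟨ +-mono-≤ (weight-bound 1 (s≤s (s≤s z≤n))) (*-monoʳ-≤ 32 rest-bound) ⟩
    81 * C + 32 * C                 ≡⟨ e₂ C ⟩
    113 * C                         <⟨ *-monoˡ-< C {{>-nonZero (choose-positive a t t≤a)}} (≤ᵇ⇒≤ 114 128 tt) ⟩
    128 * C                         ≡⟨ *-comm 128 C ⟩
    C * 128                         ∎)
    where
    open ≤-Reasoning
    rest = sumOver W (interval 3 t″)
    e₁ : ∀ s → s * 128 ≡ 32 * (4 * s)
    e₁ = solve-∀
    e₂ : ∀ c → 81 * c + 32 * c ≡ 113 * c
    e₂ = solve-∀
    e₃ : ∀ s → 4 * 5 ^ (1 + 0) * s ≡ 5 * (4 * s)
    e₃ = solve-∀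
    rest-bound : 4 * rest ≤ C
    rest-bound = *-cancelˡ-≤ 5 (≤-trans (≤-reflexive (≡-sym (e₃ rest))) (tail-sum t″ 0 ≤-refl))

levelWeights<choose : ∀ k r t M a → 2 ≤ k → 1 ≤ r → 1 ≤ t →
  (k * (t * t)) ^ t * r ^ (t ∸ 1) < suc M ^ t → M ≤ a →
  sumOver (levelWeight k r t a) (interval 2 (t ∸ 1)) < choose a t
levelWeights<choose k r t@(suc t′) M a 2≤k 1≤r 1≤t root M≤a = bySize t′ refl
  where
  kt² : ℕ
  kt² = k * (t * t)
  t≤kt² : t ≤ kt²
  t≤kt² = begin
    t           ≡⟨ ≡-sym (*-identityʳ t) ⟩
    t * 1       ≤⟨ *-monoʳ-≤ t 1≤t ⟩
    t * t       ≡⟨ ≡-sym (*-identityˡ (t * t)) ⟩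
    1 * (t * t) ≤⟨ *-monoˡ-≤ (t * t) (≤-trans (s≤s z≤n) 2≤k) ⟩
    kt²         ∎
    where open ≤-Reasoning
  kt²≤M : kt² ≤ M
  kt²≤M with kt² ≤? M
  ... | yes kt²≤M = kt²≤M
  ... | no  kt²≰M = ⊥-elim (<-irrefl refl (<-≤-trans root (begin
    suc M ^ t        ≤⟨ ^-monoˡ-≤ t (≰⇒> kt²≰M) ⟩
    kt² ^ t          ≡⟨ ≡-sym (*-identityʳ (kt² ^ t)) ⟩
    kt² ^ t * 1      ≤⟨ *-monoʳ-≤ (kt² ^ t) (≤-trans (≤-reflexive (≡-sym (^-zeroˡ t′))) (^-monoˡ-≤ t′ 1≤r)) ⟩
    kt² ^ t * r ^ t′ ∎)))
    where open ≤-Reasoning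
  t≤a : t ≤ a
  t≤a = ≤-trans t≤kt² (≤-trans kt²≤M M≤a)
  large : ∀ i → suc i ≤ t → kt² ^ suc i * r ^ i ≤ suc a ^ suc i
  large i i<t = ≤-trans (powerBound-descends kt² r (suc M) i (t ∸ suc i) (≤-trans 1≤t t≤kt²) 1≤r root′)
                        (^-monoˡ-≤ (suc i) (s≤s M≤a))
    where
    root′ : kt² ^ (suc i + (t ∸ suc i)) * r ^ (i + (t ∸ suc i)) < suc M ^ (suc i + (t ∸ suc i))
    root′ = subst (λ z → kt² ^ z * r ^ (z ∸ 1) < suc M ^ z) (≡-sym (m+[n∸m]≡n i<t)) root
  bySize : ∀ t″ → t′ ≡ t″ → sumOver (levelWeight k r t a) (interval 2 t″) < choose a t
  bySize zero     refl = choose-positive a 1 t≤a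
  bySize (suc t″) refl = LevelWeights.weights<choose k r t a 2≤k t≤a 8≤a large t″ refl
    where
    8≤a : 8 ≤ a
    8≤a = ≤-trans (*-mono-≤ 2≤k (*-mono-≤ {2} {t} (s≤s (s≤s z≤n)) (s≤s (s≤s z≤n)))) (≤-trans kt²≤M M≤a)

module _ {n : ℕ} (G : Graph n) where

  -- Walks can be reversed, so "m < d(u,v)" is symmetric in u and v.
  snocWalk : ∀ {x y z ℓ} → WalkWithin G x y ℓ → adj G y z ≡ true → WalkWithin G x z (suc ℓ)
  snocWalk here        yz = step yz here
  snocWalk (step xw W) yz = step xw (snocWalk W yz)

  reverseWalk : ∀ {x y ℓ} → WalkWithin G x y ℓ → WalkWithin G y x ℓ
  reverseWalk here                         = here
  reverseWalk (step {u = u} {w = w} uw W) = snocWalk (reverseWalk W) (trans (Graph.sym G w u) uw)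

  DistGreater-sym : ∀ {x y m} → DistGreater G x y m → DistGreater G y x m
  DistGreater-sym far W = far (reverseWalk W)

  -- Endpoints of all walks of length exactly j starting at x, with
  -- multiplicity; those of length j+1 are collected neighbour by neighbour.
  walkEnds : Fin n → ℕ → List (Fin n)
  viaNeighbour : Fin n → ℕ → Fin n → List (Fin n)

  walkEnds x zero    = x ∷ []
  walkEnds x (suc j) = concatMap (viaNeighbour x j) (allFin n)

  viaNeighbour x j w = if adj G x w then walkEnds w j else []

  walkEnds-complete : ∀ {x y ℓ} → WalkWithin G x y ℓ → Σ ℕ λ j → j ≤ ℓ × y ∈ walkEnds x j
  walkEnds-complete here = 0 , z≤n , here refl
  walkEnds-complete (step {u = x} {w = w} xw W) with walkEnds-complete W
  ... | j , j≤ℓ , y∈ = suc j , s≤s j≤ℓ ,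
    ∈-concatMap⁺ (viaNeighbour x j)
      (lose (∈-allFin w) (subst (λ b → _ ∈ (if b then walkEnds w j else [])) (≡-sym xw) y∈))

  walkEnds-one : ∀ {x y} → y ∈ walkEnds x 1 → adj G x y ≡ true
  walkEnds-one {x} {y} y∈ with find (∈-concatMap⁻ (viaNeighbour x 0) {xs = allFin n} y∈)
  ... | w , _ , y∈w with adj G x w in xw
  ...   | true with y∈w
  ...     | here refl = xw

  before : (Fin n → ℕ) → Fin n → Fin n → Bool
  before rank w v = leq (suc (rank w)) (rank v)

  earlierNeighbour : (Fin n → ℕ) → Fin n → Fin n → Bool
  earlierNeighbour rank v w = adj G v w ∧ before rank w v

  module WalkCounts (k r : ℕ) (rank : Fin n → ℕ)
    (fewEarlier : ∀ v → count (earlierNeighbour rank v) (allFin n) ≤ k)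
    (maxDegree  : ∀ v → count (adj G v) (allFin n) ≤ r) where

    walks≤ : ∀ (p : Fin n → Bool) j x → count p (walkEnds x j) ≤ r ^ j
    walks≤ p zero    x = count-≤-length p (x ∷ [])
    walks≤ p (suc j) x = begin
      count p (walkEnds x (suc j))
        ≡⟨ sumOver-concatMap (indicator p) (viaNeighbour x j) (allFin n) ⟩
      sumOver (λ w → count p (viaNeighbour x j w)) (allFin n)
        ≤⟨ sumOver-mono perNeighbour (allFin n) ⟩
      sumOver (λ w → if adj G x w then r ^ j else 0) (allFin n)
        ≡⟨ sumOver-if (adj G x) (r ^ j) (allFin n) ⟩
      count (adj G x) (allFin n) * r ^ j
        ≤⟨ *-monoˡ-≤ (r ^ j) (maxDegree x) ⟩
      r * r ^ j ∎
      where
      open ≤-Reasoning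
      perNeighbour : ∀ w → count p (viaNeighbour x j w) ≤ (if adj G x w then r ^ j else 0)
      perNeighbour w with adj G x w
      ... | true  = walks≤ p j w
      ... | false = z≤n

    -- At most j·k·r^(j-1) walks of length j from x end before a threshold
    -- θ ≤ rank x: such a walk either steps first to one of the ≤ k earlier
    -- neighbours (then r^(j-1) continuations), or to any of the ≤ r neighbours
    -- w with θ ≤ rank w, from which the same bound applies recursively.
    walksEndingBefore : ∀ j x θ → θ ≤ rank x →
      count (λ u → leq (suc (rank u)) θ) (walkEnds x j) ≤ j * k * r ^ (j ∸ 1)
    walksEndingBefore zero    x θ θ≤x rewrite leq-false-intro (suc (rank x)) θ (s≤s θ≤x) = z≤n
    walksEndingBefore (suc j) x θ θ≤x = begin
      count p (walkEnds x (suc j))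
        ≡⟨ sumOver-concatMap (indicator p) (viaNeighbour x j) (allFin n) ⟩
      sumOver (λ w → count p (viaNeighbour x j w)) (allFin n)
        ≤⟨ sumOver-mono perNeighbour (allFin n) ⟩
      sumOver (λ w → (if earlierNeighbour rank x w then r ^ j else 0) + (if adj G x w then previous else 0)) (allFin n)
        ≡⟨ sumOver-+ _ _ (allFin n) ⟩
      sumOver (λ w → if earlierNeighbour rank x w then r ^ j else 0) (allFin n)
        + sumOver (λ w → if adj G x w then previous else 0) (allFin n)
        ≡⟨ cong₂ _+_ (sumOver-if _ (r ^ j) (allFin n)) (sumOver-if _ previous (allFin n)) ⟩
      count (earlierNeighbour rank x) (allFin n) * r ^ j + count (adj G x) (allFin n) * previous
        ≤⟨ +-mono-≤ (*-monoˡ-≤ (r ^ j) (fewEarlier x)) (*-monoˡ-≤ previous (maxDegree x)) ⟩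
      k * r ^ j + r * previous
        ≡⟨ walkBound-step k r j ⟩
      suc j * k * r ^ j ∎
      where
      open ≤-Reasoning
      p : Fin n → Bool
      p u = leq (suc (rank u)) θ
      previous : ℕ
      previous = j * k * r ^ (j ∸ 1)
      perNeighbour : ∀ w → count p (viaNeighbour x j w) ≤
                           (if earlierNeighbour rank x w then r ^ j else 0) + (if adj G x w then previous else 0)
      perNeighbour w with adj G x w
      ... | false = z≤n
      ... | true with p w in pw
      ...   | true rewrite leq-complete {suc (rank w)} {rank x} (≤-trans (leq-sound _ _ pw) θ≤x) =
                ≤-trans (walks≤ p j w) (m≤m+n (r ^ j) previous)
      ...   | false = ≤-trans (walksEndingBefore j w θ (≤-pred (leq-false (suc (rank w)) θ pw))) (m≤n+m previous _)

-- A ranking of the vertices in which every vertex has at most k earlier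
-- neighbours; it exists exactly for k-degenerate graphs.
record DegeneracyOrder {n : ℕ} (k : ℕ) (G : Graph n) : Set where
  field
    rank           : Fin n → ℕ
    rank<n         : ∀ v → rank v < n
    rank-injective : ∀ u v → rank u ≡ rank v → u ≡ v
    fewEarlier     : ∀ v → count (earlierNeighbour G rank v) (allFin n) ≤ k

module _ {n : ℕ} {k : ℕ} (G : Graph n) (degenerate : Degenerate k G) where

  record RanksWithin (S : Fin n → Bool) (s : ℕ) (rank : Fin n → ℕ) : Set where
    field
      bounded    : ∀ v → S v ≡ true → rank v < s
      injective  : ∀ u v → S u ≡ true → S v ≡ true → rank u ≡ rank v → u ≡ v
      fewEarlier : ∀ v → S v ≡ true → count (λ w → adj G v w ∧ S w ∧ before G rank w v) (allFin n) ≤ k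

  emptyRanking : ∀ S s → (∀ v → ¬ S v ≡ true) → RanksWithin S s (λ _ → 0)
  emptyRanking S s none = record
    { bounded    = λ v Sv → ⊥-elim (none v Sv)
    ; injective  = λ u v Su _ _ → ⊥-elim (none u Su)
    ; fewEarlier = λ v Sv → ⊥-elim (none v Sv) }

  lowDegreeVertex : ∀ (S : Fin n → Bool) {v₀} → S v₀ ≡ true →
    Σ (Fin n) λ v → S v ≡ true × count (λ w → adj G v w ∧ S w) (allFin n) ≤ k
  lowDegreeVertex S {v₀} Sv₀ = neighboursInS (degenerate S induced induced-sym induced-sub (v₀ , Sv₀))
    where
    induced : Fin n → Fin n → Bool
    induced u w = adj G u w ∧ S u ∧ S w
    induced-sym : ∀ u w → induced u w ≡ induced w u
    induced-sym u w rewrite Graph.sym G u w with S u | S w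
    ... | true  | true  = refl
    ... | true  | false = refl
    ... | false | true  = refl
    ... | false | false = refl
    induced-sub : ∀ u w → induced u w ≡ true → (adj G u w ≡ true) × (S u ≡ true) × (S w ≡ true)
    induced-sub u w e with ∧-true⁻ {adj G u w} e
    ... | uw , Suw with ∧-true⁻ {S u} Suw
    ...   | Su , Sw = uw , Su , Sw
    -- for v ∈ S, the degree of v in the induced subgraph counts its neighbours in S
    neighboursInS : (Σ (Fin n) λ v → (S v ≡ true) × (degIn induced v ≤ k)) →
                    Σ (Fin n) λ v → S v ≡ true × count (λ w → adj G v w ∧ S w) (allFin n) ≤ k
    neighboursInS (v , Sv , deg) = v , Sv , subst (_≤ k) (count-cong (λ w → cong (λ b → adj G v w ∧ b ∧ S w) Sv) (allFin n)) deg

  without : (Fin n → Bool) → Fin n → Fin n → Bool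
  without S v w = S w ∧ not (does (w ≟ᶠ v))

  without-⊆ : ∀ S v w → without S v w ≡ true → S w ≡ true
  without-⊆ S v w e = proj₁ (∧-true⁻ e)

  without-others : ∀ S v w → S w ≡ true → ¬ w ≡ v → without S v w ≡ true
  without-others S v w Sw w≢v rewrite dec-false (w ≟ᶠ v) w≢v = ∧-true⁺ Sw refl

  without-removed : ∀ S v → without S v v ≡ false
  without-removed S v rewrite dec-true (v ≟ᶠ v) refl = ∧-zeroʳ (S v)

  module TopRank (S : Fin n → Bool) (v : Fin n) (Sv : S v ≡ true)
    (lowDegree : count (λ w → adj G v w ∧ S w) (allFin n) ≤ k)
    (s : ℕ) (rank′ : Fin n → ℕ) (ranking′ : RanksWithin (without S v) s rank′) where

    open RanksWithin ranking′ renaming (bounded to bounded′; injective to injective′; fewEarlier to fewEarlier′)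

    rank : Fin n → ℕ
    rank w = if does (w ≟ᶠ v) then s else rank′ w

    rank-v : rank v ≡ s
    rank-v = cong (λ b → if b then s else rank′ v) (dec-true (v ≟ᶠ v) refl)

    rank-others : ∀ w → ¬ w ≡ v → rank w ≡ rank′ w
    rank-others w w≢v = cong (λ b → if b then s else rank′ w) (dec-false (w ≟ᶠ v) w≢v)

    below-v : ∀ w → S w ≡ true → ¬ w ≡ v → rank w < s
    below-v w Sw w≢v = subst (_< s) (≡-sym (rank-others w w≢v)) (bounded′ w (without-others S v w Sw w≢v))

    bounded : ∀ w → S w ≡ true → rank w < suc s
    bounded w Sw = decide (w ≟ᶠ v)
      where
      decide : Dec (w ≡ v) → rank w < suc s
      decide (yes w≡v) = ≤-reflexive (cong suc (trans (cong rank w≡v) rank-v))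
      decide (no  w≢v) = m<n⇒m<1+n (below-v w Sw w≢v)

    injective : ∀ u w → S u ≡ true → S w ≡ true → rank u ≡ rank w → u ≡ w
    injective u w Su Sw eq = decide (u ≟ᶠ v) (w ≟ᶠ v)
      where
      decide : Dec (u ≡ v) → Dec (w ≡ v) → u ≡ w
      decide (yes u≡v) (yes w≡v) = trans u≡v (≡-sym w≡v)
      decide (yes u≡v) (no  w≢v) = ⊥-elim (<-irrefl (trans (≡-sym eq) (trans (cong rank u≡v) rank-v)) (below-v w Sw w≢v))
      decide (no  u≢v) (yes w≡v) = ⊥-elim (<-irrefl (trans eq (trans (cong rank w≡v) rank-v)) (below-v u Su u≢v))
      decide (no  u≢v) (no  w≢v) = injective′ u w (without-others S v u Su u≢v) (without-others S v w Sw w≢v)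
                                     (trans (≡-sym (rank-others u u≢v)) (trans eq (rank-others w w≢v)))

    -- v's earlier neighbours are among its ≤ k neighbours in S; for x ≠ v,
    -- an earlier neighbour cannot be v (which ranks above x), so the earlier
    -- neighbours are those counted by the ranking of the rest.
    fewEarlier : ∀ x → S x ≡ true → count (λ w → adj G x w ∧ S w ∧ before G rank w x) (allFin n) ≤ k
    fewEarlier x Sx = decide (x ≟ᶠ v)
      where
      decide : Dec (x ≡ v) → count (λ w → adj G x w ∧ S w ∧ before G rank w x) (allFin n) ≤ k
      decide (yes refl) = ≤-trans (count-mono forget (allFin n)) lowDegree
        where
        forget : ∀ w → (adj G v w ∧ S w ∧ before G rank w v) ≡ true → (adj G v w ∧ S w) ≡ true
        forget w e with ∧-true⁻ {adj G v w} e
        ... | vw , rest = ∧-true⁺ vw (proj₁ (∧-true⁻ {S w} rest))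
      decide (no x≢v) = ≤-trans (count-mono shrink (allFin n)) (fewEarlier′ x (without-others S v x Sx x≢v))
        where
        shrink : ∀ w → (adj G x w ∧ S w ∧ before G rank w x) ≡ true →
                       (adj G x w ∧ without S v w ∧ before G rank′ w x) ≡ true
        shrink w e with ∧-true⁻ {adj G x w} e
        ... | xw , rest with ∧-true⁻ {S w} rest
        ...   | Sw , w<x = decideW (w ≟ᶠ v)
          where
          decideW : Dec (w ≡ v) → (adj G x w ∧ without S v w ∧ before G rank′ w x) ≡ true
          decideW (yes refl) = ⊥-elim (<-asym (leq-sound _ _ w<x) (subst (rank x <_) (≡-sym rank-v) (below-v x Sx x≢v)))
          decideW (no  w≢v)  = ∧-true⁺ xw (∧-true⁺ (without-others S v w Sw w≢v)
                                 (subst₂ (λ a b → leq (suc a) b ≡ true) (rank-others w w≢v) (rank-others x x≢v) w<x))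

    ranking : RanksWithin S (suc s) rank
    ranking = record { bounded = bounded ; injective = injective ; fewEarlier = fewEarlier }

  -- Peel off a vertex of degree ≤ k in the subgraph induced by S, rank the
  -- rest recursively, and give the peeled vertex the top rank s.
  rankWithin : ∀ s (S : Fin n → Bool) → count S (allFin n) ≤ s → Σ (Fin n → ℕ) (RanksWithin S s)
  rankWithin s S |S|≤s with any? (λ v → S v Bool.≟ true)
  ... | no  empty = (λ _ → 0) , emptyRanking S s (λ v Sv → empty (v , Sv))
  rankWithin zero    S |S|≤s | yes (v₀ , Sv₀) =
    ⊥-elim (<-irrefl refl (≤-trans (count-positive (allFin n) (∈-allFin v₀) Sv₀) |S|≤s))
  rankWithin (suc s) S |S|≤s | yes (v₀ , Sv₀) with lowDegreeVertex S Sv₀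
  ... | v , Sv , lowDegree with rankWithin s (without S v) |rest|≤s
    where
    |rest|≤s : count (without S v) (allFin n) ≤ s
    |rest|≤s = ≤-pred (≤-trans (count-strict (without-⊆ S v) (allFin n) (∈-allFin v) (without-removed S v) Sv) |S|≤s)
  ...   | rank′ , ranking′ = TopRank.rank S v Sv lowDegree s rank′ ranking′ , TopRank.ranking S v Sv lowDegree s rank′ ranking′

  degeneracyOrder : DegeneracyOrder k G
  degeneracyOrder with rankWithin n (λ _ → true) (≤-trans (count-≤-length _ (allFin n)) (≤-reflexive (length-tabulate {n = n} (λ x → x))))
  ... | rank , ranking = record
    { rank           = rank
    ; rank<n         = λ v → bounded v refl
    ; rank-injective = λ u v → injective u v refl refl
    ; fewEarlier     = λ v → fewEarlier v refl }
    where open RanksWithin ranking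

module Colouring {n : ℕ} (G : Graph n) (k r t M : ℕ) (order : DegeneracyOrder k G)
  (maxDegree : ∀ v → count (adj G v) (allFin n) ≤ r)
  (2≤k : 2 ≤ k) (1≤r : 1 ≤ r) (1≤t : 1 ≤ t)
  (root : (k * (t * t)) ^ t * r ^ (t ∸ 1) < suc M ^ t) where

  open DegeneracyOrder order
  open WalkCounts G k r rank fewEarlier maxDegree

  N : ℕ
  N = k * t + M

  Compatible : (Fin n → Subset N) → Fin n → Subset N → Set
  Compatible g v f = ∣ f ∣ ≡ t × (∀ u → rank u < rank v → DistGreater G v u ∣ f ∩ g u ∣)

  module Extension (g : Fin n → Subset N) (v : Fin n) (|g|≡t : ∀ u → rank u < rank v → ∣ g u ∣ ≡ t) where

    usedBy : List (Fin n) → Subset N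
    usedBy []       = ⊥
    usedBy (w ∷ ws) = (if earlierNeighbour G rank v w then g w else ⊥) ∪ usedBy ws

    usedBy-size : ∀ ws → ∣ usedBy ws ∣ ≤ count (earlierNeighbour G rank v) ws * t
    usedBy-size []       = ≤-reflexive (∣⊥∣≡0 N)
    usedBy-size (w ∷ ws) with earlierNeighbour G rank v w in earlier
    ... | true  = ≤-trans (∣p∪q∣≤∣p∣+∣q∣ (g w) (usedBy ws))
                    (+-mono-≤ (≤-reflexive (|g|≡t w (leq-sound _ _ (proj₂ (∧-true⁻ earlier))))) (usedBy-size ws))
    ... | false = ≤-trans (∣p∪q∣≤∣p∣+∣q∣ ⊥ (usedBy ws))
                    (≤-trans (≤-reflexive (cong (_+ ∣ usedBy ws ∣) (∣⊥∣≡0 N))) (usedBy-size ws))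

    usedBy-contains : ∀ {w} ws → w ∈ ws → earlierNeighbour G rank v w ≡ true → g w ⊆ usedBy ws
    usedBy-contains {w} (w ∷ ws) (here refl) e rewrite e = p⊆p∪q (usedBy ws)
    usedBy-contains (x ∷ ws) (there w∈) e = ⊆-trans (usedBy-contains ws w∈ e) (q⊆p∪q _ (usedBy ws))

    -- v's colours must avoid those of its (at most k) earlier neighbours,
    -- which leaves a palette of at least N - kt = M colours.
    palette : Subset N
    palette = ∁ (usedBy (allFin n))

    a : ℕ
    a = ∣ palette ∣

    M≤a : M ≤ a
    M≤a = begin
      M                                ≡⟨ ≡-sym (m+n∸m≡n (k * t) M) ⟩
      N ∸ k * t                        ≤⟨ ∸-monoʳ-≤ N (≤-trans (usedBy-size (allFin n)) (*-monoˡ-≤ t (fewEarlier v))) ⟩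
      N ∸ ∣ usedBy (allFin n) ∣        ≡⟨ ≡-sym (∣∁p∣≡n∸∣p∣ (usedBy (allFin n))) ⟩
      a                                ∎
      where open ≤-Reasoning

    -- Constraint (j , F): the new set must meet F in fewer than j colours.
    -- One for every earlier vertex u at the end of a walk of length j from v,
    -- 2 ≤ j ≤ t; the other distances are handled by the palette (j = 1) or
    -- are automatic (j > t).
    Constraint : Set
    Constraint = ℕ × Subset N

    constraintsAt : ℕ → List Constraint
    constraintsAt j = concatMap (λ u → if before G rank u v then (j , g u) ∷ [] else []) (walkEnds G v j)

    constraints : List Constraint
    constraints = concatMap constraintsAt (interval 2 (t ∸ 1))

    violates : Constraint → Subset N → Bool
    violates (j , F) S = overlapsIn j F S

    violators : Constraint → ℕ
    violators c = count (λ S → within palette S ∧ violates c S) (subsetsOfSize N t)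

    violators-bound : ∀ j u → rank u < rank v → violators (j , g u) ≤ choose t j * choose (a ∸ j) (t ∸ j)
    violators-bound j u u<v = ≤-trans (count-overlapping N palette (g u) t j)
      (overlapBound-≤ _ a t j (≤-trans (∣p∩q∣≤∣p∣ (g u) palette) (≤-reflexive (|g|≡t u u<v))))

    violators-at : ∀ j → sumOver violators (constraintsAt j) ≤ levelWeight k r t a j
    violators-at j = begin
      sumOver violators (constraintsAt j)
        ≡⟨ sumOver-concatMap violators single (walkEnds G v j) ⟩
      sumOver (λ u → sumOver violators (single u)) (walkEnds G v j)
        ≤⟨ sumOver-mono perVertex (walkEnds G v j) ⟩
      sumOver (λ u → if before G rank u v then bound else 0) (walkEnds G v j)
        ≡⟨ sumOver-if _ bound (walkEnds G v j) ⟩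
      count (λ u → before G rank u v) (walkEnds G v j) * bound
        ≤⟨ *-monoˡ-≤ bound (walksEndingBefore j v (rank v) ≤-refl) ⟩
      levelWeight k r t a j ∎
      where
      open ≤-Reasoning
      single : Fin n → List Constraint
      single u = if before G rank u v then (j , g u) ∷ [] else []
      bound : ℕ
      bound = choose t j * choose (a ∸ j) (t ∸ j)
      perVertex : ∀ u → sumOver violators (single u) ≤ (if before G rank u v then bound else 0)
      perVertex u with before G rank u v in u<v
      ... | true  = ≤-trans (≤-reflexive (+-identityʳ _)) (violators-bound j u (leq-sound _ _ u<v))
      ... | false = z≤n

    fewViolators : sumOver violators constraints < count (within palette) (subsetsOfSize N t)
    fewViolators = begin-strict
      sumOver violators constraints
        ≡⟨ sumOver-concatMap violators constraintsAt (interval 2 (t ∸ 1)) ⟩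
      sumOver (λ j → sumOver violators (constraintsAt j)) (interval 2 (t ∸ 1))
        ≤⟨ sumOver-mono violators-at (interval 2 (t ∸ 1)) ⟩
      sumOver (levelWeight k r t a) (interval 2 (t ∸ 1))
        <⟨ levelWeights<choose k r t M a 2≤k 1≤r 1≤t root M≤a ⟩
      choose a t
        ≡⟨ ≡-sym (count-within N palette t) ⟩
      count (within palette) (subsetsOfSize N t) ∎
      where open ≤-Reasoning

    chosen : WantedAndFree (within palette) violates constraints (subsetsOfSize N t)
    chosen = unionBound (within palette) violates constraints (subsetsOfSize N t) fewViolators

    f : Subset N
    f = proj₁ chosen

    |f|≡t : ∣ f ∣ ≡ t
    |f|≡t = subsetsOfSize-card N t (proj₁ (proj₂ chosen))

    f⊆palette : f ⊆ palette
    f⊆palette = within-sound (proj₁ (proj₂ (proj₂ chosen)))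

    f-free : ∀ c → c ∈ constraints → violates c f ≡ false
    f-free = proj₂ (proj₂ (proj₂ chosen))

    -- The chosen set meets the colours of every earlier vertex u in fewer
    -- than d(v,u) points: a short walk to u would either be trivial, end at
    -- an earlier neighbour (whose colours are outside the palette), or
    -- witness a violated constraint.
    f-compatible : Compatible g v f
    f-compatible = |f|≡t , separated
      where
      separated : ∀ u → rank u < rank v → DistGreater G v u ∣ f ∩ g u ∣
      separated u u<v W with walkEnds-complete G W
      ... | zero , _ , here refl = <-irrefl refl u<v
      ... | suc zero , 1≤ℓ , u∈ = <-irrefl refl (≤-trans 1≤ℓ (≤-reflexive noOverlap))
        where
        neighbour : earlierNeighbour G rank v u ≡ true
        neighbour = trans (cong (_∧ before G rank u v) (walkEnds-one G u∈)) (leq-complete u<v)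
        noOverlap : ∣ f ∩ g u ∣ ≡ 0
        noOverlap = disjoint f⊆palette (usedBy-contains (allFin n) (∈-allFin u) neighbour)
      ... | j@(suc (suc _)) , j≤ℓ , u∈ = <-irrefl refl (≤-trans ℓ<j j≤ℓ)
        where
        j≤t : j ≤ t
        j≤t = ≤-trans j≤ℓ (≤-trans (∣p∩q∣≤∣p∣ f (g u)) (≤-reflexive |f|≡t))
        j∈levels : j ∈ interval 2 (t ∸ 1)
        j∈levels = ∈-interval 2 (t ∸ 1) j (s≤s (s≤s z≤n)) (≤-trans (s≤s j≤t) (≤-reflexive (cong suc (≡-sym (m+[n∸m]≡n 1≤t)))))
        u∈constraints : (j , g u) ∈ constraints
        u∈constraints = ∈-concatMap⁺ constraintsAt (lose j∈levels
          (∈-concatMap⁺ _ (lose u∈ (subst (λ b → (j , g u) ∈ (if b then (j , g u) ∷ [] else [])) (≡-sym (leq-complete u<v)) (here refl)))))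
        ℓ<j : ∣ f ∩ g u ∣ < j
        ℓ<j = leq-false j ∣ f ∩ g u ∣ (f-free (j , g u) u∈constraints)

  ColouredBelow : ℕ → (Fin n → Subset N) → Set
  ColouredBelow i g =
    (∀ v → rank v < i → ∣ g v ∣ ≡ t) ×
    (∀ u v → rank u < i → rank v < i → ¬ u ≡ v → DistGreater G u v ∣ g u ∩ g v ∣)

  private
    <-suc-≢ : ∀ {x i} → x < suc i → ¬ x ≡ i → x < i
    <-suc-≢ x<1+i x≢i = ≤∧≢⇒< (≤-pred x<1+i) x≢i

  skipRank : ∀ i g → ¬ (Σ (Fin n) λ v → rank v ≡ i) → ColouredBelow i g → ColouredBelow (suc i) g
  skipRank i g noneAt-i (sizes , separated) = (λ v v< → sizes v (below-i v v<)) ,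
                                               (λ u v u< v< → separated u v (below-i u u<) (below-i v v<))
    where
    below-i : ∀ u → rank u < suc i → rank u < i
    below-i u u<1+i = <-suc-≢ u<1+i (λ eq → noneAt-i (u , eq))

  colourRank : ∀ i g v → rank v ≡ i → ColouredBelow i g → Σ (Fin n → Subset N) (ColouredBelow (suc i))
  colourRank i g v rank-v (sizes , separated) = g′ , sizes′ , separated′
    where
    open Extension g v (λ u u<v → sizes u (subst (rank u <_) rank-v u<v))
    g′ : Fin n → Subset N
    g′ w = if does (w ≟ᶠ v) then f else g w
    g′-v : g′ v ≡ f
    g′-v = cong (λ b → if b then f else g v) (dec-true (v ≟ᶠ v) refl)
    g′-others : ∀ w → ¬ w ≡ v → g′ w ≡ g w
    g′-others w w≢v = cong (λ b → if b then f else g w) (dec-false (w ≟ᶠ v) w≢v)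
    below-v : ∀ w → rank w < suc i → ¬ w ≡ v → rank w < i
    below-v w w<1+i w≢v = <-suc-≢ w<1+i (λ eq → w≢v (rank-injective w v (trans eq (≡-sym rank-v))))
    below-v′ : ∀ w → rank w < suc i → ¬ w ≡ v → rank w < rank v
    below-v′ w w<1+i w≢v = subst (rank w <_) (≡-sym rank-v) (below-v w w<1+i w≢v)
    sizes′ : ∀ w → rank w < suc i → ∣ g′ w ∣ ≡ t
    sizes′ w w<1+i = decide (w ≟ᶠ v)
      where
      decide : Dec (w ≡ v) → ∣ g′ w ∣ ≡ t
      decide (yes refl) = trans (cong ∣_∣ g′-v) |f|≡t
      decide (no  w≢v)  = trans (cong ∣_∣ (g′-others w w≢v)) (sizes w (below-v w w<1+i w≢v))
    separated′ : ∀ u w → rank u < suc i → rank w < suc i → ¬ u ≡ w → DistGreater G u w ∣ g′ u ∩ g′ w ∣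
    separated′ u w u< w< u≢w = decide (u ≟ᶠ v) (w ≟ᶠ v)
      where
      decide : Dec (u ≡ v) → Dec (w ≡ v) → DistGreater G u w ∣ g′ u ∩ g′ w ∣
      decide (yes refl) (yes refl) = ⊥-elim (u≢w refl)
      decide (yes refl) (no  w≢v) rewrite g′-v | g′-others w w≢v =
        proj₂ f-compatible w (below-v′ w w< w≢v)
      decide (no  u≢v) (yes refl) rewrite g′-v | g′-others u u≢v =
        subst (DistGreater G u v) (cong ∣_∣ (∩-comm f (g u))) (DistGreater-sym G (proj₂ f-compatible u (below-v′ u u< u≢v)))
      decide (no  u≢v) (no  w≢v) rewrite g′-others u u≢v | g′-others w w≢v =
        separated u w (below-v u u< u≢v) (below-v w w< w≢v) u≢w

  colourNext : ∀ i g → ColouredBelow i g → Σ (Fin n → Subset N) (ColouredBelow (suc i))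
  colourNext i g coloured with any? (λ v → rank v ≟ i)
  ... | no  noneAt-i       = g , skipRank i g noneAt-i coloured
  ... | yes (v , rank-v≡i) = colourRank i g v rank-v≡i coloured

  colourBelow : ∀ i → Σ (Fin n → Subset N) (ColouredBelow i)
  colourBelow zero    = (λ _ → ⊥) , (λ _ ()) , (λ _ _ ())
  colourBelow (suc i) = colourNext i (proj₁ (colourBelow i)) (proj₂ (colourBelow i))

  colouring : HasToneColoring G t N
  colouring with colourBelow n
  ... | g , sizes , separated = g , (λ v → sizes v (rank<n v)) , (λ u v → separated u v (rank<n u) (rank<n v))

noEdges : ∀ {n} (G : Graph n) → MaxDegreeAtMost G 0 → ∀ u w → ¬ adj G u w ≡ true
noEdges {n} G maxDeg u w uw = <-irrefl refl (≤-trans (count-positive (allFin n) (∈-allFin w) uw) (maxDeg u))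

-- In a graph without edges distinct vertices are at infinite distance, so
-- giving every vertex all t colours is a t-tone t-colouring.
edgelessColouring : ∀ {n} (G : Graph n) → MaxDegreeAtMost G 0 → ∀ t → HasToneColoring G t t
edgelessColouring G maxDeg t = (λ _ → ⊤) , (λ _ → ∣⊤∣≡n t) , far
  where
  far : ∀ {m} u v → u ≢ v → DistGreater G u v m
  far u v u≢v here        = u≢v refl
  far u v u≢v (step uw _) = noEdges G maxDeg _ _ uw

-- Theorem: a k-degenerate graph (k ≥ 2) of maximum degree ≤ r has a t-tone
-- N-colouring with (N - kt)^t ≤ (kt²)^t·r^(t-1), i.e. τ_t ≤ kt + kt²·r^(1-1/t).
mainTheorem15 : (k r : ℕ) → 2 ≤ k → (n : ℕ) → (G : Graph n) →
    Degenerate k G → MaxDegreeAtMost G r →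
    (t : ℕ) → 1 ≤ t →
    Σ ℕ (λ N → ((N ∸ k * t) ^ t ≤ ((k * (t * t)) ^ t) * (r ^ (t ∸ 1))) × HasToneColoring G t N)
mainTheorem15 k zero 2≤k n G _ maxDeg t@(suc _) 1≤t = t , bound , edgelessColouring G maxDeg t
  where
  -- without edges t colours suffice, and t ≤ kt
  bound : (t ∸ k * t) ^ t ≤ (k * (t * t)) ^ t * 0 ^ (t ∸ 1)
  bound rewrite m≤n⇒m∸n≡0 (m≤n*m t k {{>-nonZero (≤-trans (s≤s z≤n) 2≤k)}}) = z≤n
mainTheorem15 k r@(suc _) 2≤k n G degenerate maxDeg t 1≤t
  with integerRoot ((k * (t * t)) ^ t * r ^ (t ∸ 1)) t 1≤t
... | M , M^t≤ , below =
  k * t + M , excess , Colouring.colouring G k r t M (degeneracyOrder G degenerate) maxDeg 2≤k (s≤s z≤n) 1≤t below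
  where
  -- the colours beyond kt number exactly M, the integer t-th root
  excess : (k * t + M ∸ k * t) ^ t ≤ (k * (t * t)) ^ t * r ^ (t ∸ 1)
  excess rewrite m+n∸m≡n (k * t) M = M^t≤
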